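{- Let $m\in \mathbb{Z}_{\ge 2}$. Every index $\mathbf{n}\in\{(n_0,\ldots,n_{m-1})\in \mathbb{Z}^m_{\ge0}:\ n_0\ge n_1\ge \cdots \ge n_{m-1}\}$ is normal with respect to $(1,\log(1+z),\ldots,\log^{m-1}(1+z))$.
   Context: Here $\log(1+z)=\sum_{k\ge1}(-1)^{k+1}z^k/k$ is a formal power series (over $\mathbb{Q}$, or any field of characteristic $0$). For $\mathbf{f}=(f_1,\ldots,f_r)\in K[[z]]^r$ and $\mathbf{n}\in\mathbb{Z}_{\ge0}^r$, a weight $\mathbf{n}$ Padé approximation of $\mathbf f$ is a series $\sum_jA_jf_j$ with $(A_1,\ldots,A_r)\in K[z]^r$ not all zero, $\deg A_j\le n_j$, and $\mathrm{ord}\sum_jA_jf_j\ge\sum_{j}(n_j+1)-1$. $\mathbf n$ is normal with respect to $\mathbf f$ if every weight $\mathbf n$ Padé approximation $R$ of $\mathbf f$ satisfies $\mathrm{ord}R=\sum_{j}(n_j+1)-1$. -}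

module Defs where

open import Data.Nat using (ℕ; zero; suc; _∸_; _≤_; _<_)
open import Data.Fin using (Fin; toℕ)
import Data.Fin as F
open import Data.Integer using (ℤ; -1ℤ) renaming (_^_ to _^ℤ_)
open import Data.Rational using (ℚ; 0ℚ; 1ℚ; _+_; _*_; _/_)
open import Data.Product using (Σ; _×_; ∃-syntax)
open import Relation.Binary.PropositionalEquality using (_≡_; _≢_)

-- Formal power series over ℚ, represented by their coefficient sequences.
Series : Set
Series = ℕ → ℚ

sumUpTo : ℕ → (ℕ → ℚ) → ℚ
sumUpTo zero    f = f 0
sumUpTo (suc k) f = sumUpTo k f + f (suc k)

sumFin : (m : ℕ) → (Fin m → ℚ) → ℚ
sumFin zero    f = 0ℚ
sumFin (suc m) f = f F.zero + sumFin m (λ j → f (F.suc j))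

oneS : Series
oneS zero    = 1ℚ
oneS (suc _) = 0ℚ

_⊛_ : Series → Series → Series
(f ⊛ g) k = sumUpTo k (λ i → f i * g (k ∸ i))

powS : Series → ℕ → Series
powS f zero    = oneS
powS f (suc j) = f ⊛ powS f j

-- log(1+z) = Σ_{k≥1} (-1)^{k+1} z^k / k
logS : Series
logS zero    = 0ℚ
logS (suc j) = (-1ℤ ^ℤ j) / suc j

logPowers : (m : ℕ) → Fin m → Series
logPowers m j = powS logS (toℕ j)

HasDegreeAtMost : Series → ℕ → Set
HasDegreeAtMost A d = ∀ k → d < k → A k ≡ 0ℚ

linComb : (r : ℕ) → (Fin r → Series) → (Fin r → Series) → Series
linComb r A f k = sumFin r (λ j → (A j ⊛ f j) k)

weightSum : (r : ℕ) → (Fin r → ℕ) → ℕ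
weightSum zero    n = 0
weightSum (suc r) n = suc (n F.zero) Data.Nat.+ weightSum r (λ j → n (F.suc j))

OrdAtLeast : Series → ℕ → Set
OrdAtLeast R N = ∀ k → k < N → R k ≡ 0ℚ

OrdEq : Series → ℕ → Set
OrdEq R N = OrdAtLeast R N × R N ≢ 0ℚ

IsPadeApprox : (r : ℕ) → (Fin r → Series) → (Fin r → ℕ) → (Fin r → Series) → Set
IsPadeApprox r f n A =
  (∀ j → HasDegreeAtMost (A j) (n j)) ×
  (∃[ j ] ∃[ k ] A j k ≢ 0ℚ) ×
  OrdAtLeast (linComb r A f) (weightSum r n ∸ 1)

IsNormal : (r : ℕ) → (Fin r → Series) → (Fin r → ℕ) → Set
IsNormal r f n = ∀ A → IsPadeApprox r f n A → OrdEq (linComb r A f) (weightSum r n ∸ 1)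

module Submission where

open import Defs
open import Data.Nat using (ℕ; _≤_)
open import Data.Fin using (Fin)
import Data.Fin
open import Data.Fin as Fin using (toℕ)
import Data.Fin.Properties as FinP

open import Data.Nat as ℕ using (zero; suc; _∸_; _<_; z≤n; s≤s)
import Data.Nat.Properties as ℕP
open import Data.Integer as ℤ using (-1ℤ) renaming (+_ to ⁺_)
import Data.Integer.Properties as ℤP
open import Data.Rational as ℚ using (ℚ; 0ℚ; 1ℚ; _+_; _*_; -_; toℚᵘ)
import Data.Rational.Properties as ℚP
open import Data.Rational.Unnormalised as ℚᵘ using (mkℚᵘ; *≡*)
import Data.Rational.Unnormalised.Properties as ℚᵘP
open import Data.Rational.Solver using (module +-*-Solver)
open import Relation.Binary.PropositionalEquality
open import Relation.Nullary using (yes; no)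
open import Data.Sum using (_⊎_; inj₁; inj₂)
open import Data.Product using (_×_; _,_; ∃-syntax)
open import Data.Empty using (⊥-elim)
open +-*-Solver using (solve; _:+_; _:*_; :-_; _:=_; con)

-- Let θ = (1+z) d/dz act on coefficient sequences.  θ is a derivation with θ log = 1, hence
-- θ log^j = j log^{j−1}.  So for polynomials A_0, …, A_{M−1} (and A_M = 0)
--     (θ − c) Σ_j A_j log^j  =  Σ_j ((θ − c) A_j + (j+1) A_{j+1}) log^j,
-- and θ − c lowers the order at z = 0 by at most one.  If deg A_j < b_j for an antitone
-- profile b with b_0 = c + 1, the new coefficients fit b lowered by one at the end J of its
-- top run.  By induction on Σ b_j, a combination Σ A_j log^j of order ≥ Σ b_j therefore has
-- all A_j = 0 (`vanishing`); going back from the reduced family uses that ker(θ − c) is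
-- spanned by (1+z)^c.  Hence no Padé approximation of weight n has order ≥ Σ (n_j + 1).

ι : ℕ → ℚ
ι zero    = 0ℚ
ι (suc n) = 1ℚ + ι n

ι-+ : ∀ a b → ι (a ℕ.+ b) ≡ ι a + ι b
ι-+ zero    b = sym (ℚP.+-identityˡ (ι b))
ι-+ (suc a) b = trans (cong (1ℚ +_) (ι-+ a b)) (sym (ℚP.+-assoc 1ℚ (ι a) (ι b)))

ι≃n/1 : ∀ n → toℚᵘ (ι n) ℚᵘ.≃ mkℚᵘ (⁺ n) 0
ι≃n/1 zero    = *≡* refl
ι≃n/1 (suc n) = ℚᵘP.≃-trans (ℚP.toℚᵘ-homo-+ 1ℚ (ι n))
  (ℚᵘP.≃-trans (ℚᵘP.+-congʳ (toℚᵘ 1ℚ) (ι≃n/1 n))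
    (*≡* (cong (ℤ._* ⁺ 1) (cong (λ t → ⁺ 1 ℤ.+ t) (ℤP.*-identityʳ (⁺ n))))))

ι-suc≢0 : ∀ n → ι (suc n) ≢ 0ℚ
ι-suc≢0 n eq with ℚᵘP.≃-trans (ℚᵘP.≃-sym (ι≃n/1 (suc n))) (ℚP.toℚᵘ-cong eq)
... | *≡* ()

cancel-nonzero : ∀ x y → x ≢ 0ℚ → x * y ≡ 0ℚ → y ≡ 0ℚ
cancel-nonzero x y x≢0 xy≡0 = begin
    y                 ≡⟨ ℚP.*-identityˡ y ⟨
    1ℚ * y            ≡⟨ cong (_* y) (ℚP.*-inverseˡ x) ⟨
    (ℚ.1/ x * x) * y  ≡⟨ ℚP.*-assoc (ℚ.1/ x) x y ⟩
    ℚ.1/ x * (x * y)  ≡⟨ cong (ℚ.1/ x *_) xy≡0 ⟩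
    ℚ.1/ x * 0ℚ       ≡⟨ ℚP.*-zeroʳ (ℚ.1/ x) ⟩
    0ℚ                ∎
  where
  open ≡-Reasoning
  instance _ = ℚ.≢-nonZero x≢0

+-interchange : ∀ a b c d → (a + b) + (c + d) ≡ (a + c) + (b + d)
+-interchange = solve 4 (λ a b c d → (a :+ b) :+ (c :+ d) := (a :+ c) :+ (b :+ d)) refl

sumUpTo-cong : ∀ k {h h′ : ℕ → ℚ} → (∀ i → i ≤ k → h i ≡ h′ i) → sumUpTo k h ≡ sumUpTo k h′
sumUpTo-cong zero    eq = eq 0 z≤n
sumUpTo-cong (suc k) eq =
  cong₂ _+_ (sumUpTo-cong k (λ i i≤k → eq i (ℕP.m≤n⇒m≤1+n i≤k))) (eq (suc k) ℕP.≤-refl)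

sumUpTo-+ : ∀ k (h h′ : ℕ → ℚ) → sumUpTo k (λ i → h i + h′ i) ≡ sumUpTo k h + sumUpTo k h′
sumUpTo-+ zero    h h′ = refl
sumUpTo-+ (suc k) h h′ =
  trans (cong (_+ (h (suc k) + h′ (suc k))) (sumUpTo-+ k h h′))
        (+-interchange (sumUpTo k h) (sumUpTo k h′) (h (suc k)) (h′ (suc k)))

sumUpTo-* : ∀ k c (h : ℕ → ℚ) → sumUpTo k (λ i → c * h i) ≡ c * sumUpTo k h
sumUpTo-* zero    c h = refl
sumUpTo-* (suc k) c h =
  trans (cong (_+ (c * h (suc k))) (sumUpTo-* k c h)) (sym (ℚP.*-distribˡ-+ c _ _))

sumUpTo-0 : ∀ k {h : ℕ → ℚ} → (∀ i → i ≤ k → h i ≡ 0ℚ) → sumUpTo k h ≡ 0ℚ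
sumUpTo-0 zero    h≡0 = h≡0 0 z≤n
sumUpTo-0 (suc k) h≡0 =
  trans (cong₂ _+_ (sumUpTo-0 k (λ i i≤k → h≡0 i (ℕP.m≤n⇒m≤1+n i≤k))) (h≡0 (suc k) ℕP.≤-refl))
        (ℚP.+-identityˡ 0ℚ)

sumUpTo-head : ∀ k (h : ℕ → ℚ) → sumUpTo (suc k) h ≡ h 0 + sumUpTo k (λ i → h (suc i))
sumUpTo-head zero    h = refl
sumUpTo-head (suc k) h =
  trans (cong (_+ h (suc (suc k))) (sumUpTo-head k h)) (ℚP.+-assoc (h 0) _ _)

sum< : ℕ → (ℕ → ℚ) → ℚ
sum< zero    h = 0ℚ
sum< (suc M) h = h 0 + sum< M (λ j → h (suc j))

sum<-cong : ∀ M {h h′ : ℕ → ℚ} → (∀ j → h j ≡ h′ j) → sum< M h ≡ sum< M h′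
sum<-cong zero    eq = refl
sum<-cong (suc M) eq = cong₂ _+_ (eq 0) (sum<-cong M (λ j → eq (suc j)))

sum<-+ : ∀ M (h h′ : ℕ → ℚ) → sum< M (λ j → h j + h′ j) ≡ sum< M h + sum< M h′
sum<-+ zero    h h′ = sym (ℚP.+-identityˡ 0ℚ)
sum<-+ (suc M) h h′ = trans (cong ((h 0 + h′ 0) +_) (sum<-+ M _ _))
  (+-interchange (h 0) (h′ 0) (sum< M (λ j → h (suc j))) (sum< M (λ j → h′ (suc j))))

sum<-* : ∀ M c (h : ℕ → ℚ) → sum< M (λ j → c * h j) ≡ c * sum< M h
sum<-* zero    c h = sym (ℚP.*-zeroʳ c)
sum<-* (suc M) c h = trans (cong (c * h 0 +_) (sum<-* M c _)) (sym (ℚP.*-distribˡ-+ c _ _))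

sum<-0 : ∀ M {h : ℕ → ℚ} → (∀ j → h j ≡ 0ℚ) → sum< M h ≡ 0ℚ
sum<-0 zero    h≡0 = refl
sum<-0 (suc M) h≡0 = trans (cong₂ _+_ (h≡0 0) (sum<-0 M (λ j → h≡0 (suc j)))) (ℚP.+-identityˡ 0ℚ)

sum<-last : ∀ M (h : ℕ → ℚ) → sum< (suc M) h ≡ sum< M h + h M
sum<-last zero    h = trans (ℚP.+-identityʳ (h 0)) (sym (ℚP.+-identityˡ (h 0)))
sum<-last (suc M) h =
  trans (cong (h 0 +_) (sum<-last M (λ j → h (suc j)))) (sym (ℚP.+-assoc (h 0) _ _))

_⊕_ : Series → Series → Series
(f ⊕ g) k = f k + g k

_·_ : ℚ → Series → Series
(c · f) k = c * f k

infixl 6 _⊕_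
infixl 7 _·_

Vanishes : Series → Set
Vanishes f = ∀ k → f k ≡ 0ℚ

⊛-congˡ : ∀ {f f′} g → f ≗ f′ → ∀ k → (f ⊛ g) k ≡ (f′ ⊛ g) k
⊛-congˡ g eq k = sumUpTo-cong k (λ i _ → cong (_* g (k ∸ i)) (eq i))

⊛-congʳ : ∀ f {g g′} → g ≗ g′ → ∀ k → (f ⊛ g) k ≡ (f ⊛ g′) k
⊛-congʳ f eq k = sumUpTo-cong k (λ i _ → cong (f i *_) (eq (k ∸ i)))

⊛-⊕ˡ : ∀ f f′ g k → ((f ⊕ f′) ⊛ g) k ≡ (f ⊛ g) k + (f′ ⊛ g) k
⊛-⊕ˡ f f′ g k =
  trans (sumUpTo-cong k (λ i _ → ℚP.*-distribʳ-+ (g (k ∸ i)) (f i) (f′ i))) (sumUpTo-+ k _ _)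

⊛-⊕ʳ : ∀ f g g′ k → (f ⊛ (g ⊕ g′)) k ≡ (f ⊛ g) k + (f ⊛ g′) k
⊛-⊕ʳ f g g′ k =
  trans (sumUpTo-cong k (λ i _ → ℚP.*-distribˡ-+ (f i) (g (k ∸ i)) (g′ (k ∸ i)))) (sumUpTo-+ k _ _)

⊛-·ˡ : ∀ c f g k → ((c · f) ⊛ g) k ≡ c * (f ⊛ g) k
⊛-·ˡ c f g k = trans (sumUpTo-cong k (λ i _ → ℚP.*-assoc c (f i) (g (k ∸ i)))) (sumUpTo-* k c _)

*-pull-middle : ∀ a b d → a * (b * d) ≡ b * (a * d)
*-pull-middle = solve 3 (λ a b d → a :* (b :* d) := b :* (a :* d)) refl

⊛-·ʳ : ∀ c f g k → (f ⊛ (c · g)) k ≡ c * (f ⊛ g) k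
⊛-·ʳ c f g k =
  trans (sumUpTo-cong k (λ i _ → *-pull-middle (f i) c (g (k ∸ i)))) (sumUpTo-* k c _)

⊛-vanishesˡ : ∀ {f} g → Vanishes f → Vanishes (f ⊛ g)
⊛-vanishesˡ {f} g f≡0 k =
  sumUpTo-0 k (λ i _ → trans (cong (_* g (k ∸ i)) (f≡0 i)) (ℚP.*-zeroˡ (g (k ∸ i))))

⊛-vanishesʳ : ∀ f {g} → Vanishes g → Vanishes (f ⊛ g)
⊛-vanishesʳ f {g} g≡0 k =
  sumUpTo-0 k (λ i _ → trans (cong (f i *_) (g≡0 (k ∸ i))) (ℚP.*-zeroʳ (f i)))

⊛-identityˡ : ∀ g k → (oneS ⊛ g) k ≡ g k
⊛-identityˡ g zero    = ℚP.*-identityˡ (g 0)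
⊛-identityˡ g (suc k) = begin
    sumUpTo (suc k) (λ i → oneS i * g (suc k ∸ i))
      ≡⟨ sumUpTo-head k _ ⟩
    1ℚ * g (suc k) + sumUpTo k (λ i → 0ℚ * g (k ∸ i))
      ≡⟨ cong₂ _+_ (ℚP.*-identityˡ (g (suc k))) (sumUpTo-0 k (λ i _ → ℚP.*-zeroˡ (g (k ∸ i)))) ⟩
    g (suc k) + 0ℚ
      ≡⟨ ℚP.+-identityʳ (g (suc k)) ⟩
    g (suc k) ∎
  where open ≡-Reasoning

-- The Euler operator z d/dz, the derivative d/dz, and θ = (1 + z) d/dz = z d/dz + d/dz.
euler : Series → Series
euler f k = ι k * f k

deriv : Series → Series
deriv f k = ι (suc k) * f (suc k)

θ : Series → Series
θ f = euler f ⊕ deriv f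

-- k · Σ_{i ≤ k} h i = Σ_{i ≤ k} i · h i + Σ_{i ≤ k} (k - i) · h i: the weight k of the
-- coefficient (f g)_k splits between the two factors.  Both Leibniz rules rest on this.
split-weight : ∀ k (h : ℕ → ℚ) →
  ι k * sumUpTo k h ≡ sumUpTo k (λ i → ι i * h i) + sumUpTo k (λ i → ι (k ∸ i) * h i)
split-weight k h = begin
    ι k * sumUpTo k h                                    ≡⟨ sumUpTo-* k (ι k) h ⟨
    sumUpTo k (λ i → ι k * h i)                          ≡⟨ sumUpTo-cong k split ⟩
    sumUpTo k (λ i → ι i * h i + ι (k ∸ i) * h i)        ≡⟨ sumUpTo-+ k _ _ ⟩
    sumUpTo k (λ i → ι i * h i) + sumUpTo k (λ i → ι (k ∸ i) * h i) ∎
  where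
  open ≡-Reasoning
  split : ∀ i → i ≤ k → ι k * h i ≡ ι i * h i + ι (k ∸ i) * h i
  split i i≤k = begin
    ι k * h i                  ≡⟨ cong (λ t → ι t * h i) (ℕP.m+[n∸m]≡n i≤k) ⟨
    ι (i ℕ.+ (k ∸ i)) * h i    ≡⟨ cong (_* h i) (ι-+ i (k ∸ i)) ⟩
    (ι i + ι (k ∸ i)) * h i    ≡⟨ ℚP.*-distribʳ-+ (h i) (ι i) (ι (k ∸ i)) ⟩
    ι i * h i + ι (k ∸ i) * h i ∎

euler-leibniz : ∀ f g k → euler (f ⊛ g) k ≡ (euler f ⊛ g) k + (f ⊛ euler g) k
euler-leibniz f g k = trans (split-weight k (λ i → f i * g (k ∸ i)))
  (cong₂ _+_ (sumUpTo-cong k (λ i _ → sym (ℚP.*-assoc (ι i) (f i) (g (k ∸ i)))))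
             (sumUpTo-cong k (λ i _ → *-pull-middle (ι (k ∸ i)) (f i) (g (k ∸ i)))))

deriv-leibniz : ∀ f g k → deriv (f ⊛ g) k ≡ (deriv f ⊛ g) k + (f ⊛ deriv g) k
deriv-leibniz f g k = begin
    ι (suc k) * (f ⊛ g) (suc k)
      ≡⟨ split-weight (suc k) X ⟩
    sumUpTo (suc k) (λ i → ι i * X i) + sumUpTo (suc k) (λ i → ι (suc k ∸ i) * X i)
      ≡⟨ cong₂ _+_ first second ⟩
    0ℚ + (deriv f ⊛ g) k + ((f ⊛ deriv g) k + 0ℚ)
      ≡⟨ cong₂ _+_ (ℚP.+-identityˡ ((deriv f ⊛ g) k)) (ℚP.+-identityʳ ((f ⊛ deriv g) k)) ⟩
    (deriv f ⊛ g) k + (f ⊛ deriv g) k ∎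
  where
  open ≡-Reasoning
  X : ℕ → ℚ
  X i = f i * g (suc k ∸ i)
  -- The term i = 0 carries weight 0; the others are (deriv f ⊛ g)_k after the shift i ↦ i + 1.
  first : sumUpTo (suc k) (λ i → ι i * X i) ≡ 0ℚ + (deriv f ⊛ g) k
  first = trans (sumUpTo-head k _) (cong₂ _+_ (ℚP.*-zeroˡ (X 0))
    (sumUpTo-cong k (λ i _ → sym (ℚP.*-assoc (ι (suc i)) (f (suc i)) (g (k ∸ i))))))
  -- The term i = k + 1 carries weight 0; the others are (f ⊛ deriv g)_k.
  second : sumUpTo (suc k) (λ i → ι (suc k ∸ i) * X i) ≡ (f ⊛ deriv g) k + 0ℚ
  second = cong₂ _+_
    (sumUpTo-cong k (λ i i≤k → trans
      (cong (λ t → ι t * (f i * g t)) (ℕP.+-∸-assoc 1 i≤k))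
      (*-pull-middle (ι (suc (k ∸ i))) (f i) (g (suc (k ∸ i))))))
    (trans (cong (λ t → ι t * X (suc k)) (ℕP.n∸n≡0 k)) (ℚP.*-zeroˡ (X (suc k))))

θ-leibniz : ∀ f g k → θ (f ⊛ g) k ≡ (θ f ⊛ g) k + (f ⊛ θ g) k
θ-leibniz f g k = begin
    euler (f ⊛ g) k + deriv (f ⊛ g) k
      ≡⟨ cong₂ _+_ (euler-leibniz f g k) (deriv-leibniz f g k) ⟩
    ((euler f ⊛ g) k + (f ⊛ euler g) k) + ((deriv f ⊛ g) k + (f ⊛ deriv g) k)
      ≡⟨ +-interchange ((euler f ⊛ g) k) ((f ⊛ euler g) k) ((deriv f ⊛ g) k) ((f ⊛ deriv g) k) ⟩
    ((euler f ⊛ g) k + (deriv f ⊛ g) k) + ((f ⊛ euler g) k + (f ⊛ deriv g) k)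
      ≡⟨ cong₂ _+_ (⊛-⊕ˡ (euler f) (deriv f) g k) (⊛-⊕ʳ f (euler g) (deriv g) k) ⟨
    (θ f ⊛ g) k + (f ⊛ θ g) k ∎
  where open ≡-Reasoning

sign : ℕ → ℚ
sign j = (-1ℤ ℤ.^ j) ℚ./ 1

ι-log-coeff : ∀ j → ι (suc j) * logS (suc j) ≡ sign j
ι-log-coeff j = ℚP.toℚᵘ-injective
  (ℚᵘP.≃-trans (ℚP.toℚᵘ-homo-* (ι (suc j)) (logS (suc j)))
  (ℚᵘP.≃-trans (ℚᵘP.*-cong (ι≃n/1 (suc j)) (ℚP.toℚᵘ-fromℚᵘ (mkℚᵘ s j)))
  (ℚᵘP.≃-trans (*≡* cross) (ℚᵘP.≃-sym (ℚP.toℚᵘ-fromℚᵘ (mkℚᵘ s 0))))))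
  where
  s = -1ℤ ℤ.^ j
  cross : (⁺ suc j ℤ.* s) ℤ.* ⁺ 1 ≡ s ℤ.* ⁺ suc (j ℕ.+ 0)
  cross = trans (ℤP.*-identityʳ (⁺ suc j ℤ.* s))
     (trans (ℤP.*-comm (⁺ suc j) s) (cong (λ t → s ℤ.* ⁺ suc t) (sym (ℕP.+-identityʳ j))))

sign-suc : ∀ j → sign (suc j) ≡ - sign j
sign-suc j = ℚP.toℚᵘ-injective
  (ℚᵘP.≃-trans (ℚP.toℚᵘ-fromℚᵘ (mkℚᵘ (-1ℤ ℤ.* s) 0))
  (ℚᵘP.≃-trans (*≡* (cong (ℤ._* ⁺ 1) (ℤP.-1*i≡-i s)))
  (ℚᵘP.≃-trans (ℚᵘP.-‿cong (ℚᵘP.≃-sym (ℚP.toℚᵘ-fromℚᵘ (mkℚᵘ s 0))))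
  (ℚᵘP.≃-sym (ℚP.toℚᵘ-homo‿- (sign j))))))
  where
  s = -1ℤ ℤ.^ j

θ-log : θ logS ≗ oneS
θ-log zero    = refl
θ-log (suc j) = trans (cong₂ _+_ (ι-log-coeff j) (trans (ι-log-coeff (suc j)) (sign-suc j)))
                      (ℚP.+-inverseʳ (sign j))

logPow : ℕ → Series
logPow = powS logS

θ-logPow-zero : Vanishes (θ (logPow 0))
θ-logPow-zero zero    = refl
θ-logPow-zero (suc k) =
  trans (cong₂ _+_ (ℚP.*-zeroʳ (ι (suc k))) (ℚP.*-zeroʳ (ι (suc (suc k))))) (ℚP.+-identityʳ 0ℚ)

-- θ log^{j+1} = (j + 1) log^j, by the Leibniz rule and θ log = 1.
θ-logPow : ∀ j → θ (logPow (suc j)) ≗ ι (suc j) · logPow j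
θ-logPow j k = begin
    θ (logS ⊛ logPow j) k                           ≡⟨ θ-leibniz logS (logPow j) k ⟩
    (θ logS ⊛ logPow j) k + (logS ⊛ θ (logPow j)) k ≡⟨ cong₂ _+_ θlog-term (log-θ-term j) ⟩
    1ℚ * logPow j k + ι j * logPow j k              ≡⟨ ℚP.*-distribʳ-+ (logPow j k) 1ℚ (ι j) ⟨
    ι (suc j) * logPow j k                          ∎
  where
  open ≡-Reasoning
  θlog-term : (θ logS ⊛ logPow j) k ≡ 1ℚ * logPow j k
  θlog-term = trans (⊛-congˡ (logPow j) θ-log k)
                    (trans (⊛-identityˡ (logPow j) k) (sym (ℚP.*-identityˡ (logPow j k))))
  log-θ-term : ∀ i → (logS ⊛ θ (logPow i)) k ≡ ι i * logPow i k
  log-θ-term zero    = trans (⊛-vanishesʳ logS θ-logPow-zero k) (sym (ℚP.*-zeroˡ (logPow 0 k)))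
  log-θ-term (suc i) = trans (⊛-congʳ logS (θ-logPow i) k) (⊛-·ʳ (ι (suc i)) logS (logPow i) k)

-- Θ c = (1 + z) d/dz − c.  Its kernel is spanned by (1 + z)^c; the lemmas below are the
-- facts about this kernel and about degrees that the reduction step needs.
Θ : ℕ → Series → Series
Θ c f = θ f ⊕ (- ι c) · f

DegreeBelow : ℕ → Series → Set
DegreeBelow d f = ∀ k → d ≤ k → f k ≡ 0ℚ

Θ-at-zeros : ∀ c f k → f k ≡ 0ℚ → f (suc k) ≡ 0ℚ → Θ c f k ≡ 0ℚ
Θ-at-zeros c f k fk≡0 fk+1≡0 =
  trans (cong₂ (λ x y → ι k * x + ι (suc k) * y + (- ι c) * x) fk≡0 fk+1≡0)
        (zeros (ι k) (ι (suc k)) (- ι c))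
  where
  zeros : ∀ p q r → p * 0ℚ + q * 0ℚ + r * 0ℚ ≡ 0ℚ
  zeros = solve 3 (λ p q r → p :* con 0ℚ :+ q :* con 0ℚ :+ r :* con 0ℚ := con 0ℚ) refl

-- The coefficient of z^c in Θ c f only involves f_{c+1}.
Θ-at-top : ∀ c f → f (suc c) ≡ 0ℚ → Θ c f c ≡ 0ℚ
Θ-at-top c f fc+1≡0 =
  trans (cong (λ y → ι c * f c + ι (suc c) * y + (- ι c) * f c) fc+1≡0)
        (cancels (ι c) (f c) (ι (suc c)))
  where
  cancels : ∀ p a q → p * a + q * 0ℚ + (- p) * a ≡ 0ℚ
  cancels = solve 3 (λ p a q → p :* a :+ q :* con 0ℚ :+ (:- p) :* a := con 0ℚ) refl

Θ-degree : ∀ c d f → DegreeBelow d f → DegreeBelow d (Θ c f)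
Θ-degree c d f deg k d≤k = Θ-at-zeros c f k (deg k d≤k) (deg (suc k) (ℕP.m≤n⇒m≤1+n d≤k))

Θ-degree-top : ∀ c f → DegreeBelow (suc c) f → DegreeBelow c (Θ c f)
Θ-degree-top c f deg k c≤k with k ℕ.≟ c
... | yes refl = Θ-at-top c f (deg (suc c) ℕP.≤-refl)
... | no k≢c   = Θ-at-zeros c f k (deg k (ℕP.≤∧≢⇒< c≤k (≢-sym k≢c))) (deg (suc k) (s≤s c≤k))

Θ-kernel-up : ∀ c f → f 0 ≡ 0ℚ → Vanishes (Θ c f) → Vanishes f
Θ-kernel-up c f f0≡0 Θf≡0 zero    = f0≡0
Θ-kernel-up c f f0≡0 Θf≡0 (suc k) = cancel-nonzero (ι (suc k)) (f (suc k)) (ι-suc≢0 k) (begin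
    ι (suc k) * f (suc k)
      ≡⟨ survivor (ι k) (ι (suc k)) (f (suc k)) (- ι c) ⟨
    ι k * 0ℚ + ι (suc k) * f (suc k) + (- ι c) * 0ℚ
      ≡⟨ cong (λ x → ι k * x + ι (suc k) * f (suc k) + (- ι c) * x) fk≡0 ⟨
    Θ c f k
      ≡⟨ Θf≡0 k ⟩
    0ℚ ∎)
  where
  open ≡-Reasoning
  fk≡0 = Θ-kernel-up c f f0≡0 Θf≡0 k
  survivor : ∀ p q a r → p * 0ℚ + q * a + r * 0ℚ ≡ q * a
  survivor = solve 4 (λ p q a r → p :* con 0ℚ :+ q :* a :+ r :* con 0ℚ := q :* a) refl

-- An element of ker Θ c of degree ≤ c whose z^c-coefficient vanishes is zero
-- (induction downwards from z^c: the coefficient of z^k in Θ c f is (k − c) f_k + (k+1) f_{k+1}).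
Θ-kernel-down : ∀ c f → DegreeBelow (suc c) f → f c ≡ 0ℚ → Vanishes (Θ c f) → Vanishes f
Θ-kernel-down c f deg fc≡0 Θf≡0 k with ℕP.≤-total c k
... | inj₁ c≤k with k ℕ.≟ c
...   | yes refl = fc≡0
...   | no k≢c   = deg k (ℕP.≤∧≢⇒< c≤k (≢-sym k≢c))
Θ-kernel-down c f deg fc≡0 Θf≡0 k | inj₂ k≤c = below (c ∸ k) k (ℕP.m+[n∸m]≡n k≤c)
  where
  below : ∀ d k → k ℕ.+ d ≡ c → f k ≡ 0ℚ
  below zero    k k+0≡c = trans (cong f (trans (sym (ℕP.+-identityʳ k)) k+0≡c)) fc≡0
  below (suc d) k k+d+1≡c = cancel-nonzero (ι (suc d)) (f k) (ι-suc≢0 d) (ℚP.neg-injective (begin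
      - (ι (suc d) * f k)
        ≡⟨ remainder (ι k) (f k) (ι (suc k)) (ι (suc d)) ⟨
      ι k * f k + ι (suc k) * 0ℚ + (- (ι k + ι (suc d))) * f k
        ≡⟨ cong₂ (λ y t → ι k * f k + ι (suc k) * y + (- t) * f k) fk+1≡0 c≡ ⟨
      Θ c f k
        ≡⟨ Θf≡0 k ⟩
      0ℚ ∎))
    where
    open ≡-Reasoning
    fk+1≡0 : f (suc k) ≡ 0ℚ
    fk+1≡0 = below d (suc k) (trans (sym (ℕP.+-suc k d)) k+d+1≡c)
    c≡ : ι c ≡ ι k + ι (suc d)
    c≡ = trans (cong ι (sym k+d+1≡c)) (ι-+ k (suc d))
    remainder : ∀ p a q r → p * a + q * 0ℚ + (- (p + r)) * a ≡ - (r * a)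
    remainder = solve 4 (λ p a q r → p :* a :+ q :* con 0ℚ :+ (:- (p :+ r)) :* a := :- (r :* a)) refl

Family : Set
Family = ℕ → Series

combo : Family → ℕ → Series
combo A M k = sum< M (λ j → (A j ⊛ logPow j) k)

θ-sum< : ∀ M (H : Family) k → θ (λ i → sum< M (λ j → H j i)) k ≡ sum< M (λ j → θ (H j) k)
θ-sum< M H k = trans
  (cong₂ _+_ (sym (sum<-* M (ι k) (λ j → H j k))) (sym (sum<-* M (ι (suc k)) (λ j → H j (suc k)))))
  (sym (sum<-+ M _ _))

-- By θ log^j = j log^{j-1}, applying θ to the logarithms shifts the family down by one:
-- Σ_{j<M} A_j θ(log^j) = Σ_{j<M} (j+1) A_{j+1} log^j, provided A_M = 0.
θ-on-logs : ∀ M (A : Family) → Vanishes (A M) → ∀ k →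
  sum< M (λ j → (A j ⊛ θ (logPow j)) k) ≡ sum< M (λ j → ι (suc j) * (A (suc j) ⊛ logPow j) k)
θ-on-logs zero    A AM≡0 k = refl
θ-on-logs (suc M) A AM≡0 k = begin
    (A 0 ⊛ θ (logPow 0)) k + sum< M (λ j → (A (suc j) ⊛ θ (logPow (suc j))) k)
      ≡⟨ cong₂ _+_ (⊛-vanishesʳ (A 0) θ-logPow-zero k) (sum<-cong M shifted) ⟩
    0ℚ + sum< M h      ≡⟨ ℚP.+-identityˡ (sum< M h) ⟩
    sum< M h           ≡⟨ ℚP.+-identityʳ (sum< M h) ⟨
    sum< M h + 0ℚ      ≡⟨ cong (sum< M h +_) top ⟨
    sum< M h + h M     ≡⟨ sum<-last M h ⟨
    sum< (suc M) h     ∎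
  where
  open ≡-Reasoning
  h : ℕ → ℚ
  h j = ι (suc j) * (A (suc j) ⊛ logPow j) k
  shifted : ∀ j → (A (suc j) ⊛ θ (logPow (suc j))) k ≡ h j
  shifted j = trans (⊛-congʳ (A (suc j)) (θ-logPow j) k) (⊛-·ʳ (ι (suc j)) (A (suc j)) (logPow j) k)
  top : h M ≡ 0ℚ
  top = trans (cong (ι (suc M) *_) (⊛-vanishesˡ (logPow M) AM≡0 k)) (ℚP.*-zeroʳ (ι (suc M)))

reduce : ℕ → Family → Family
reduce c A j = Θ c (A j) ⊕ ι (suc j) · A (suc j)

reduce-combo : ∀ c M (A : Family) → Vanishes (A M) → combo (reduce c A) M ≗ Θ c (combo A M)
reduce-combo c M A AM≡0 k = begin
    combo (reduce c A) M k
      ≡⟨ sum<-cong M expand ⟩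
    sum< M (λ j → ΘA j + (- ι c) * AL j + SA j)
      ≡⟨ trans (sum<-+ M _ SA) (cong (_+ sum< M SA) (sum<-+ M ΘA _)) ⟩
    sum< M ΘA + sum< M (λ j → (- ι c) * AL j) + sum< M SA
      ≡⟨ cong (λ t → sum< M ΘA + t + sum< M SA) (sum<-* M (- ι c) AL) ⟩
    sum< M ΘA + (- ι c) * combo A M k + sum< M SA
      ≡⟨ swap-last (sum< M ΘA) ((- ι c) * combo A M k) (sum< M SA) ⟩
    sum< M ΘA + sum< M SA + (- ι c) * combo A M k
      ≡⟨ cong (λ t → sum< M ΘA + t + (- ι c) * combo A M k) (θ-on-logs M A AM≡0 k) ⟨
    sum< M ΘA + sum< M (λ j → (A j ⊛ θ (logPow j)) k) + (- ι c) * combo A M k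
      ≡⟨ cong (_+ (- ι c) * combo A M k) leibniz ⟨
    Θ c (combo A M) k ∎
  where
  open ≡-Reasoning
  ΘA AL SA : ℕ → ℚ
  ΘA j = (θ (A j) ⊛ logPow j) k
  AL j = (A j ⊛ logPow j) k
  SA j = ι (suc j) * (A (suc j) ⊛ logPow j) k
  expand : ∀ j → (reduce c A j ⊛ logPow j) k ≡ ΘA j + (- ι c) * AL j + SA j
  expand j = trans (⊛-⊕ˡ (Θ c (A j)) _ (logPow j) k) (cong₂ _+_
    (trans (⊛-⊕ˡ (θ (A j)) _ (logPow j) k) (cong (ΘA j +_) (⊛-·ˡ (- ι c) (A j) (logPow j) k)))
    (⊛-·ˡ (ι (suc j)) (A (suc j)) (logPow j) k))
  swap-last : ∀ a b d → a + b + d ≡ a + d + b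
  swap-last = solve 3 (λ a b d → a :+ b :+ d := a :+ d :+ b) refl
  leibniz : θ (combo A M) k ≡ sum< M ΘA + sum< M (λ j → (A j ⊛ θ (logPow j)) k)
  leibniz = trans (θ-sum< M (λ j → A j ⊛ logPow j) k)
                  (trans (sum<-cong M (λ j → θ-leibniz (A j) (logPow j) k)) (sum<-+ M _ _))

downward-induction : ∀ {P : ℕ → Set} M → (∀ j → M ≤ j → P j) → (∀ j → P (suc j) → P j) → ∀ j → P j
downward-induction {P} M base step j = from M j (ℕP.m≤m+n M j)
  where
  from : ∀ t j → M ≤ t ℕ.+ j → P j
  from zero    j M≤j   = base j M≤j
  from (suc t) j M≤t+j = step j (from t (suc j) (subst (M ≤_) (sym (ℕP.+-suc t j)) M≤t+j))

reduce-kernel : ∀ c (A : Family) j → Vanishes (reduce c A j) → Vanishes (A (suc j)) → Vanishes (Θ c (A j))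
reduce-kernel c A j red≡0 next≡0 k = begin
    Θ c (A j) k                               ≡⟨ ℚP.+-identityʳ (Θ c (A j) k) ⟨
    Θ c (A j) k + 0ℚ                          ≡⟨ cong (Θ c (A j) k +_) (ℚP.*-zeroʳ (ι (suc j))) ⟨
    Θ c (A j) k + ι (suc j) * 0ℚ              ≡⟨ cong (λ x → Θ c (A j) k + ι (suc j) * x) (next≡0 k) ⟨
    reduce c A j k                            ≡⟨ red≡0 k ⟩
    0ℚ                                        ∎
  where open ≡-Reasoning

-- The constant term of Σ_{j<M} A_j log^j is that of A_0 when A_1, A_2, … vanish, since log(1+z)
-- has no constant term (for M = 0 both sides vanish).
combo-constant-term : ∀ M (A : Family) → (∀ j → M ≤ j → Vanishes (A j)) →
  (∀ j → Vanishes (A (suc j))) → combo A M 0 ≡ A 0 0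
combo-constant-term zero    A beyond tail≡0 = sym (beyond 0 z≤n 0)
combo-constant-term (suc M) A beyond tail≡0 =
  trans (cong (A 0 0 * 1ℚ +_) (sum<-0 M (λ j → ⊛-vanishesˡ (logPow (suc j)) (tail≡0 j) 0)))
        (trans (ℚP.+-identityʳ (A 0 0 * 1ℚ)) (ℚP.*-identityʳ (A 0 0)))

-- The z^c-coefficient of (reduce c A)_j is (j+1)·[z^c] A_{j+1}; so all A_{j+1} have vanishing
-- z^c-coefficient and, going down from j = M, lie in ker Θ c, hence vanish; finally
-- A_0 ∈ ker Θ c has no constant term.
reduce-injective : ∀ c M (A : Family) → (∀ j → DegreeBelow (suc c) (A j)) →
  (∀ j → M ≤ j → Vanishes (A j)) → combo A M 0 ≡ 0ℚ → (∀ j → Vanishes (reduce c A j)) →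
  ∀ j → Vanishes (A j)
reduce-injective c M A deg beyond combo0≡0 red≡0 = all
  where
  top-coeff : ∀ j → A (suc j) c ≡ 0ℚ
  top-coeff j = cancel-nonzero (ι (suc j)) (A (suc j) c) (ι-suc≢0 j) (begin
      ι (suc j) * A (suc j) c
        ≡⟨ ℚP.+-identityˡ _ ⟨
      0ℚ + ι (suc j) * A (suc j) c
        ≡⟨ cong (_+ ι (suc j) * A (suc j) c) (Θ-at-top c (A j) (deg j (suc c) ℕP.≤-refl)) ⟨
      reduce c A j c
        ≡⟨ red≡0 j c ⟩
      0ℚ ∎)
    where open ≡-Reasoning
  tail : ∀ j → Vanishes (A (suc j))
  tail = downward-induction M (λ j M≤j → beyond (suc j) (ℕP.m≤n⇒m≤1+n M≤j))
    (λ j next≡0 → Θ-kernel-down c (A (suc j)) (deg (suc j)) (top-coeff j)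
                    (reduce-kernel c A (suc j) (red≡0 (suc j)) next≡0))
  head : Vanishes (A 0)
  head = Θ-kernel-up c (A 0) (trans (sym (combo-constant-term M A beyond tail)) combo0≡0)
                     (reduce-kernel c A 0 (red≡0 0) (tail 0))
  all : ∀ j → Vanishes (A j)
  all zero    = head
  all (suc j) = tail j

Antitone : (ℕ → ℕ) → Set
Antitone b = ∀ i j → i ≤ j → b j ≤ b i

BoundedBy : (ℕ → ℕ) → Family → Set
BoundedBy b A = ∀ j → DegreeBelow (b j) (A j)

DegreeBelow-mono : ∀ {d d′} f → d ≤ d′ → DegreeBelow d f → DegreeBelow d′ f
DegreeBelow-mono f d≤d′ deg k d′≤k = deg k (ℕP.≤-trans d≤d′ d′≤k)

DegreeBelow-⊕· : ∀ d f s g → DegreeBelow d f → DegreeBelow d g → DegreeBelow d (f ⊕ s · g)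
DegreeBelow-⊕· d f s g degf degg k d≤k =
  trans (cong₂ (λ x y → x + s * y) (degf k d≤k) (degg k d≤k))
        (trans (ℚP.+-identityˡ (s * 0ℚ)) (ℚP.*-zeroʳ s))

sumℕ : ℕ → (ℕ → ℕ) → ℕ
sumℕ zero    b = 0
sumℕ (suc M) b = b 0 ℕ.+ sumℕ M (λ j → b (suc j))

sumℕ-cong : ∀ M {b b′ : ℕ → ℕ} → (∀ j → b j ≡ b′ j) → sumℕ M b ≡ sumℕ M b′
sumℕ-cong zero    eq = refl
sumℕ-cong (suc M) eq = cong₂ ℕ._+_ (eq 0) (sumℕ-cong M (λ j → eq (suc j)))

sumℕ-lower : ∀ M J (b b′ : ℕ → ℕ) → J < M → (∀ j → j ≢ J → b j ≡ b′ j) → b J ≡ suc (b′ J) →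
  sumℕ M b ≡ suc (sumℕ M b′)
sumℕ-lower (suc M) zero    b b′ _ others bJ =
  cong₂ ℕ._+_ bJ (sumℕ-cong M (λ j → others (suc j) (λ ())))
sumℕ-lower (suc M) (suc J) b b′ (s≤s J<M) others bJ =
  trans (cong₂ ℕ._+_ (others 0 (λ ()))
          (sumℕ-lower M J (λ j → b (suc j)) (λ j → b′ (suc j)) J<M
            (λ j j≢J → others (suc j) (λ e → j≢J (ℕP.suc-injective e))) bJ))
        (ℕP.+-suc (b′ 0) _)

head≤sumℕ : ∀ M b → b M ≡ 0 → b 0 ≤ sumℕ M b
head≤sumℕ zero    b b0≡0 = ℕP.≤-reflexive b0≡0
head≤sumℕ (suc M) b _    = ℕP.m≤m+n (b 0) _

run-end : ∀ (b : ℕ → ℕ) v M → b 0 ≡ v → b M ≢ v → ∃[ J ] (J < M × b J ≡ v × b (suc J) ≢ v)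
run-end b v zero    b0≡v bM≢v = ⊥-elim (bM≢v b0≡v)
run-end b v (suc M) b0≡v bM≢v with b 1 ℕ.≟ v
... | no b1≢v  = 0 , s≤s z≤n , b0≡v , b1≢v
... | yes b1≡v with run-end (λ j → b (suc j)) v M b1≡v bM≢v
...   | J , J<M , bJ≡v , bJ+1≢v = suc J , s≤s J<M , bJ≡v , bJ+1≢v

_[_≔_] : (ℕ → ℕ) → ℕ → ℕ → ℕ → ℕ
(b [ J ≔ c ]) j with j ℕ.≟ J
... | yes _ = c
... | no _  = b j

update-cases : ∀ (P : ℕ → Set) b J c j → (j ≡ J → P c) → (j ≢ J → P (b j)) → P ((b [ J ≔ c ]) j)
update-cases P b J c j same other with j ℕ.≟ J
... | yes j≡J = same j≡J
... | no j≢J  = other j≢J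

sumℕ-lower-at : ∀ M J b c → J < M → b J ≡ suc c → sumℕ M b ≡ suc (sumℕ M (b [ J ≔ c ]))
sumℕ-lower-at M J b c J<M bJ≡ = sumℕ-lower M J b (b [ J ≔ c ]) J<M
  (λ j j≢J → update-cases (b j ≡_) b J c j (λ j≡J → ⊥-elim (j≢J j≡J)) (λ _ → refl))
  (trans bJ≡ (cong suc (update-cases (c ≡_) b J c J (λ _ → refl) (λ J≢J → ⊥-elim (J≢J refl)))))

-- Let J end the run at the top of an antitone profile b, with b J = c + 1 and b (J+1) ≤ c.
-- Lowering b at J keeps the profile antitone ...
lower-antitone : ∀ b J c → Antitone b → b J ≡ suc c → b (suc J) ≤ c → Antitone (b [ J ≔ c ])
lower-antitone b J c anti bJ≡ bJ+1≤c i j i≤j =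
  update-cases (λ x → (b [ J ≔ c ]) j ≤ x) b J c i
    (λ { refl → update-cases (_≤ c) b J c j (λ _ → ℕP.≤-refl)
                  (λ j≢J → ℕP.≤-trans (anti (suc J) j (ℕP.≤∧≢⇒< i≤j (≢-sym j≢J))) bJ+1≤c) })
    (λ _ → update-cases (_≤ b i) b J c j
                  (λ { refl → ℕP.≤-trans (ℕP.n≤1+n c) (subst (_≤ b i) bJ≡ (anti i J i≤j)) })
                  (λ _ → anti i j i≤j))

-- ... and bounds the reduced family: Θ c lowers the degree of A_J below c, while the other
-- summands already have degree < c, resp. < b j.
reduce-bounded : ∀ b J c A → Antitone b → b J ≡ suc c → b (suc J) ≤ c → BoundedBy b A →
  BoundedBy (b [ J ≔ c ]) (reduce c A)
reduce-bounded b J c A anti bJ≡ bJ+1≤c bounded j =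
  update-cases (λ d → DegreeBelow d (reduce c A j)) b J c j
    (λ { refl → DegreeBelow-⊕· c (Θ c (A J)) (ι (suc J)) (A (suc J))
                  (Θ-degree-top c (A J) (subst (λ d → DegreeBelow d (A J)) bJ≡ (bounded J)))
                  (DegreeBelow-mono (A (suc J)) bJ+1≤c (bounded (suc J))) })
    (λ _ → DegreeBelow-⊕· (b j) (Θ c (A j)) (ι (suc j)) (A (suc j))
                  (Θ-degree c (b j) (A j) (bounded j))
                  (DegreeBelow-mono (A (suc j)) (anti j (suc j) (ℕP.n≤1+n j)) (bounded (suc j))))

Θ-order : ∀ c F N → OrdAtLeast F (suc N) → OrdAtLeast (Θ c F) N
Θ-order c F N ord k k<N = Θ-at-zeros c F k (ord k (ℕP.m<n⇒m<1+n k<N)) (ord (suc k) (s≤s k<N))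

-- Let b be an antitone profile vanishing from M on, A a family with deg A_j < b j,
-- and N ≥ Σ_{j<M} b j.  If Σ_{j<M} A_j log^j vanishes to order N, then A = 0.
-- Induction on N: with c + 1 = b 0 and J the end of the top run of b, the reduced family
-- reduce c A fits the profile b lowered at J, whose sum is one less, and its combination
-- Θ c (Σ A_j log^j) vanishes to order N − 1; so reduce c A = 0, and hence A = 0.
vanishing : ∀ N M b (A : Family) → Antitone b → b M ≡ 0 → BoundedBy b A → sumℕ M b ≤ N →
  OrdAtLeast (combo A M) N → ∀ j → Vanishes (A j)
vanishing N M b A anti bM≡0 bounded sum≤N ord with b 0 in b0≡
... | zero = λ j k → bounded j k (ℕP.≤-trans (anti 0 j z≤n) (subst (_≤ k) (sym b0≡) z≤n))
vanishing zero M b A anti bM≡0 bounded sum≤N ord | suc c =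
  ⊥-elim (ℕP.1+n≢0 (ℕP.n≤0⇒n≡0 (subst (_≤ 0) b0≡ (ℕP.≤-trans (head≤sumℕ M b bM≡0) sum≤N))))
vanishing (suc N) M b A anti bM≡0 bounded sum≤N ord | suc c
  with run-end b (suc c) M b0≡ (λ bM≡ → ℕP.0≢1+n (trans (sym bM≡0) bM≡))
... | J , J<M , bJ≡ , bJ+1≢ =
  reduce-injective c M A below-top beyond (ord 0 (s≤s z≤n)) reduced≡0
  where
  b′ : ℕ → ℕ
  b′ = b [ J ≔ c ]
  beyond : ∀ j → M ≤ j → Vanishes (A j)
  beyond j M≤j k = bounded j k (ℕP.≤-trans (anti M j M≤j) (ℕP.≤-trans (ℕP.≤-reflexive bM≡0) z≤n))
  bJ+1≤c : b (suc J) ≤ c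
  bJ+1≤c = ℕP.≤-pred (ℕP.≤∧≢⇒< (subst (b (suc J) ≤_) bJ≡ (anti J (suc J) (ℕP.n≤1+n J))) bJ+1≢)
  b′M≡0 : b′ M ≡ 0
  b′M≡0 = update-cases (_≡ 0) b J c M (λ M≡J → ⊥-elim (ℕP.<⇒≢ J<M (sym M≡J))) (λ _ → bM≡0)
  sum′≤N : sumℕ M b′ ≤ N
  sum′≤N = ℕP.≤-pred (subst (_≤ suc N) (sumℕ-lower-at M J b c J<M bJ≡) sum≤N)
  ord′ : OrdAtLeast (combo (reduce c A) M) N
  ord′ k k<N = trans (reduce-combo c M A (beyond M ℕP.≤-refl) k) (Θ-order c (combo A M) N ord k k<N)
  reduced≡0 : ∀ j → Vanishes (reduce c A j)
  reduced≡0 = vanishing N M b′ (reduce c A) (lower-antitone b J c anti bJ≡ bJ+1≤c) b′M≡0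
                (reduce-bounded b J c A anti bJ≡ bJ+1≤c bounded) sum′≤N ord′
  below-top : ∀ j → DegreeBelow (suc c) (A j)
  below-top j = DegreeBelow-mono (A j) (subst (b j ≤_) b0≡ (anti 0 j z≤n)) (bounded j)

extend : ∀ {X : Set} m → (Fin m → X) → X → ℕ → X
extend zero    f d j       = d
extend (suc m) f d zero    = f Fin.zero
extend (suc m) f d (suc j) = extend m (λ i → f (Fin.suc i)) d j

extend-toℕ : ∀ {X : Set} m (f : Fin m → X) d (i : Fin m) → extend m f d (toℕ i) ≡ f i
extend-toℕ (suc m) f d Fin.zero    = refl
extend-toℕ (suc m) f d (Fin.suc i) = extend-toℕ m (λ i → f (Fin.suc i)) d i

extend-beyond : ∀ {X : Set} m (f : Fin m → X) d j → m ≤ j → extend m f d j ≡ d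
extend-beyond zero    f d j       _         = refl
extend-beyond (suc m) f d (suc j) (s≤s m≤j) = extend-beyond m (λ i → f (Fin.suc i)) d j m≤j

index-cases : ∀ m j → (∃[ i ] toℕ {m} i ≡ j) ⊎ m ≤ j
index-cases m j with j ℕ.<? m
... | yes j<m = inj₁ (Fin.fromℕ< j<m , FinP.toℕ-fromℕ< j<m)
... | no j≮m  = inj₂ (ℕP.≮⇒≥ j≮m)

sumFin≡sum< : ∀ m (f : Fin m → ℚ) (h : ℕ → ℚ) → (∀ i → h (toℕ i) ≡ f i) → sumFin m f ≡ sum< m h
sumFin≡sum< zero    f h eq = refl
sumFin≡sum< (suc m) f h eq = cong₂ _+_ (sym (eq Fin.zero))
  (sumFin≡sum< m (λ i → f (Fin.suc i)) (λ j → h (suc j)) (λ i → eq (Fin.suc i)))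

profile : ∀ m → (Fin m → ℕ) → ℕ → ℕ
profile m n = extend m (λ i → suc (n i)) 0

weightSum≡sumℕ : ∀ m (n : Fin m → ℕ) → weightSum m n ≡ sumℕ m (profile m n)
weightSum≡sumℕ zero    n = refl
weightSum≡sumℕ (suc m) n = cong (suc (n Fin.zero) ℕ.+_) (weightSum≡sumℕ m (λ i → n (Fin.suc i)))

profile-antitone : ∀ m (n : Fin m → ℕ) → (∀ i j → i Fin.≤ j → n j ≤ n i) → Antitone (profile m n)
profile-antitone m n anti i j i≤j with index-cases m j
... | inj₂ m≤j = subst (_≤ profile m n i) (sym (extend-beyond m _ 0 j m≤j)) z≤n
... | inj₁ (j′ , refl) with index-cases m i
...   | inj₂ m≤i = ⊥-elim (ℕP.<⇒≱ (FinP.toℕ<n j′) (ℕP.≤-trans m≤i i≤j))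
...   | inj₁ (i′ , refl)
      rewrite extend-toℕ m (λ i → suc (n i)) 0 i′ | extend-toℕ m (λ i → suc (n i)) 0 j′ =
        s≤s (anti i′ j′ i≤j)

zeroS : Series
zeroS _ = 0ℚ

profile-bounds : ∀ m (n : Fin m → ℕ) A → (∀ j → HasDegreeAtMost (A j) (n j)) →
  BoundedBy (profile m n) (extend m A zeroS)
profile-bounds m n A deg j with index-cases m j
... | inj₂ m≤j = λ k _ → cong (λ f → f k) (extend-beyond m A zeroS j m≤j)
... | inj₁ (i , refl)
    rewrite extend-toℕ m (λ i → suc (n i)) 0 i | extend-toℕ m A zeroS i = deg i

OrdAtLeast-step : ∀ R N → OrdAtLeast R (N ∸ 1) → R (N ∸ 1) ≡ 0ℚ → OrdAtLeast R N
OrdAtLeast-step R (suc N) ord RN≡0 k (s≤s k≤N) with ℕP.m≤n⇒m<n∨m≡n k≤N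
... | inj₁ k<N  = ord k k<N
... | inj₂ refl = RN≡0

-- Proposition 5.2.  Padding the weight and the Padé
-- system by zeros, a Padé approximation of weight n with ord R ≥ Σ (n_j + 1) would make the
-- main lemma force all A_j to vanish, contradicting the non-triviality of the system.
proposition5p2 : (m : ℕ) → 2 ≤ m → (n : Fin m → ℕ) →
    (∀ i j → i Data.Fin.≤ j → n j ≤ n i) →
    IsNormal m (logPowers m) n
proposition5p2 m _ n anti A (deg , (j₀ , k₀ , Aj₀k₀≢0) , ord) = ord , λ R≡0 →
  Aj₀k₀≢0 (trans (sym (cong (λ f → f k₀) (extend-toℕ m A zeroS j₀)))
    (vanishing (weightSum m n) m (profile m n) (extend m A zeroS)
      (profile-antitone m n anti) (extend-beyond m _ 0 m ℕP.≤-refl) (profile-bounds m n A deg)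
      (ℕP.≤-reflexive (sym (weightSum≡sumℕ m n))) (ord-padded R≡0) (toℕ j₀) k₀))
  where
  combo≡linComb : ∀ k → combo (extend m A zeroS) m k ≡ linComb m A (logPowers m) k
  combo≡linComb k = sym (sumFin≡sum< m _ _
    (λ i → ⊛-congˡ (logPow (toℕ i)) (λ t → cong (λ f → f t) (extend-toℕ m A zeroS i)) k))
  ord-padded : linComb m A (logPowers m) (weightSum m n ∸ 1) ≡ 0ℚ →
    OrdAtLeast (combo (extend m A zeroS) m) (weightSum m n)
  ord-padded R≡0 k k<W = trans (combo≡linComb k) (OrdAtLeast-step _ (weightSum m n) ord R≡0 k k<W)
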